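{- For any rooted tree $x$ with $|x|=k+1$ and any nonnegative integer $a$, $$\sum_{|t|=k+a+1}m(x;t)\,n(\bullet;t)=n(\bullet;x)\prod_{i=2}^{a+1}\binom{k+i}{2},$$ the sum being over rooted trees $t$ with $k+a+1$ vertices.
   Context: A rooted tree is a finite partially ordered set (elements called vertices) with a unique greatest element, the root, such that for every vertex $v$ the set of vertices greater than $v$ is a chain; if $v$ covers $w$, $w$ is a child of $v$. We regard it as a directed graph with edges from each vertex to its children; a vertex is terminal if it has no children. Rooted trees are considered up to isomorphism; $|t|$ is the number of vertices, $\bullet$ the one-vertex tree. Write $t\lhd t'$ if $t$ is obtained from $t'$ by deleting one terminal non-root vertex and the edge into it. For $t\lhd t'$, $n_1(t;t')$ is the number of vertices of $t$ at which attaching a new edge to a new terminal vertex yields $t'$, and $m_1(t;t')$ is the number of edges of $t'$ whose removal (with their terminal endpoint) leaves $t$. Let $k\{\mathcal T\}$ be the vector space over a field of characteristic $0$ with basis the rooted trees, with linear operators $\mathfrak N(t)=\sum_{t\lhd t'}n_1(t;t')t'$ and $\mathfrak P(t)=\sum_{t'\lhd t}m_1(t';t)t'$ ($\mathfrak P(\bullet)=0$). For rooted trees with $|t'|-|t|=j\ge0$, $n(t;t')$ is the coefficient of $t'$ in $\mathfrak N^j(t)$ and $m(t;t')$ is the coefficient of $t$ in $\mathfrak P^j(t')$. -}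

module Defs where

open import Data.Nat using (ℕ; zero; suc; _+_; _*_; _∸_)
open import Data.Nat.Combinatorics using (_C_)
open import Data.List using (List; []; _∷_; _++_; map; concatMap; [_])
open import Relation.Nullary using (¬_)
open import Data.List.Relation.Binary.Permutation.Homogeneous using (Permutation)

-- Rooted trees are represented by (planar) trees: a vertex together with the
-- list of its children.  "Rooted trees up to isomorphism" are the classes of
-- the relation _≅_ below.
data PTree : Set where
  node : List PTree → PTree

• : PTree
• = node []

data _≅_ : PTree → PTree → Set where
  node : ∀ {cs ds} → Permutation _≅_ cs ds → node cs ≅ node ds

mutual
  size : PTree → ℕ
  size (node cs) = suc (sizes cs)

  sizes : List PTree → ℕ
  sizes []       = 0
  sizes (c ∷ cs) = size c + sizes cs

-- all trees obtained by attaching a new edge to a new terminal vertex at a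
-- vertex of t, one entry per vertex of t.
mutual
  grafts : PTree → List PTree
  grafts (node cs) = node (• ∷ cs) ∷ map node (graftsIn cs)

  graftsIn : List PTree → List (List PTree)
  graftsIn []       = []
  graftsIn (c ∷ cs) = map (_∷ cs) (grafts c) ++ map (c ∷_) (graftsIn cs)

-- all trees obtained by deleting one terminal non-root vertex (and the edge
-- into it), one entry per such edge of t.
mutual
  prunes : PTree → List PTree
  prunes (node cs) = map node (prunesIn cs)

  prunesIn : List PTree → List (List PTree)
  prunesIn []                    = []
  prunesIn (node [] ∷ cs)        = cs ∷ map (• ∷_) (prunesIn cs)
  prunesIn (node (d ∷ ds) ∷ cs)  =
    map (_∷ cs) (prunes (node (d ∷ ds))) ++ map (node (d ∷ ds) ∷_) (prunesIn cs)

-- Elements of k{T} with nonnegative integer coefficients are represented as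
-- formal sums, i.e. lists of trees (a tree occurring c times up to ≅ has
-- coefficient c).
𝔑 : List PTree → List PTree
𝔑 = concatMap grafts

𝔓 : List PTree → List PTree
𝔓 = concatMap prunes

iter : {A : Set} → ℕ → (A → A) → A → A
iter zero    f a = a
iter (suc n) f a = f (iter n f a)

data Count (t : PTree) : List PTree → ℕ → Set where
  []   : Count t [] 0
  hit  : ∀ {x xs c} → x ≅ t → Count t xs c → Count t (x ∷ xs) (suc c)
  miss : ∀ {x xs c} → ¬ (x ≅ t) → Count t xs c → Count t (x ∷ xs) c

NCoeff : PTree → PTree → ℕ → Set
NCoeff t t' c = Count t' (iter (size t' ∸ size t) 𝔑 [ t ]) c

MCoeff : PTree → PTree → ℕ → Set
MCoeff t t' c = Count t (iter (size t' ∸ size t) 𝔓 [ t' ]) c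

Reps : ℕ → List PTree → Set
Reps N L = (∀ t → Data.List.Membership.Propositional._∈_ t L → size t ≡ N)
         × (∀ t → size t ≡ N → Count t L 1)
  where open import Relation.Binary.PropositionalEquality using (_≡_)
        open import Data.Product using (_×_)
        import Data.List.Membership.Propositional

prodC : ℕ → ℕ → ℕ
prodC k zero    = 1
prodC k (suc a) = prodC k a * ((k + (a + 2)) C 2)

-- Grafting and pruning act on the list of children of a node as derivations of the
-- free monoid: each replaces one child by the results of grafting at, or pruning in,
-- that child.  The commutator of two derivations is the derivation generated by their
-- commutator on letters, and on a single child t that commutator is |t| copies of t
-- (prune the vertex just grafted).  Hence 𝔓𝔑 − 𝔑𝔓 multiplies every tree by its number
-- of vertices, already for multisets of planar trees.  All trees of 𝔑ʲ(•) have j + 1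
-- vertices, so 𝔓 𝔑ʲ⁺¹(•) = C(j+2,2) 𝔑ʲ(•) and 𝔓ᵃ 𝔑ᵏ⁺ᵃ(•) = ∏ᵢ C(k+i,2) 𝔑ᵏ(•).  The
-- coefficient of x on the right is n(•;x) ∏ᵢ C(k+i,2); on the left, grouping the trees
-- of 𝔑ᵏ⁺ᵃ(•) by isomorphism class, pruning being compatible with isomorphism, gives
-- Σₜ m(x;t) n(•;t).
module Submission where

open import Defs
open import Algebra.Bundles using (CommutativeMonoid)
open import Data.Empty using (⊥-elim)
open import Data.List
  using (List; []; _∷_; _++_; [_]; map; concat; concatMap; replicate; zipWith; cartesianProductWith)
open import Data.List.Membership.Propositional using (_∈_)
open import Data.List.Properties
  using ( map-++; map-∘; map-id; map-cong; map-cong-local; map-replicate; ++-assoc; ++-identityʳ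
        ; concatMap-++; concatMap-map; map-concatMap; concatMap-cong; concatMap-pure
        ; cartesianProductWith-zeroʳ )
open import Data.List.Relation.Binary.Pointwise as Pointwise using (Pointwise; []; _∷_)
import Data.List.Relation.Binary.Permutation.Homogeneous as Perm
open import Data.List.Relation.Binary.Permutation.Propositional as ↭
  using (_↭_; ↭-refl; ↭-sym; ↭-trans; ↭-reflexive; ↭-prep; module PermutationReasoning)
open import Data.List.Relation.Binary.Permutation.Propositional.Properties
  using (++⁺; ++⁺ˡ; ++⁺ʳ; shifts; map⁺; ++-commutativeMonoid)
import Data.List.Relation.Binary.Permutation.Setoid as PermutationSetoid
import Data.List.Relation.Binary.Permutation.Setoid.Properties as PermutationSetoidProperties
open import Data.List.Relation.Unary.All as All using (All; []; _∷_)
import Data.List.Relation.Unary.All.Properties as All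
open import Data.List.Relation.Unary.Any using (here; there)
open import Data.Nat using (ℕ; zero; suc; _+_; _*_; _∸_)
open import Data.Nat.Combinatorics using (_C_; nC1≡n; nCk+nC[k+1]≡[n+1]C[k+1])
open import Data.Nat.ListAction using (sum)
open import Data.Nat.Properties
  using (+-suc; +-assoc; +-comm; +-identityʳ; *-comm; *-suc; *-zeroʳ; m+n∸n≡m; +-commutativeSemigroup)
open import Data.Product using (_×_; _,_; ∃-syntax; proj₁; proj₂)
open import Function using (_∘_; flip)
open import Level using (0ℓ)
open import Relation.Binary.Bundles using (Setoid)
open import Relation.Binary.PropositionalEquality as ≡
  using (_≡_; refl; sym; cong; cong₂; subst; module ≡-Reasoning)

infix 6 _·_

_·_ : ∀ {A : Set} → ℕ → List A → List A
n · xs = concat (replicate n xs)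

module _ {A : Set} where

  replicate-+ : ∀ m n (x : A) → replicate (m + n) x ≡ replicate m x ++ replicate n x
  replicate-+ zero    n x = refl
  replicate-+ (suc m) n x = cong (x ∷_) (replicate-+ m n x)

  ·-[] : ∀ n → n · [] ≡ ([] {A = A})
  ·-[] zero    = refl
  ·-[] (suc n) = ·-[] n

  ·-+ : ∀ m n (xs : List A) → (m + n) · xs ≡ m · xs ++ n · xs
  ·-+ zero    n xs = refl
  ·-+ (suc m) n xs = ≡.trans (cong (xs ++_) (·-+ m n xs)) (sym (++-assoc xs (m · xs) (n · xs)))

  ·-* : ∀ m n (xs : List A) → m · (n · xs) ≡ (m * n) · xs
  ·-* zero    n xs = refl
  ·-* (suc m) n xs = ≡.trans (cong (n · xs ++_) (·-* m n xs)) (sym (·-+ n (m * n) xs))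

  ·⁺ : ∀ n {xs ys : List A} → xs ↭ ys → n · xs ↭ n · ys
  ·⁺ zero    p = ↭-refl
  ·⁺ (suc n) p = ++⁺ p (·⁺ n p)

  replicate-++-· : ∀ n x (xs : List A) → replicate n x ++ n · xs ↭ n · (x ∷ xs)
  replicate-++-· zero    x xs = ↭-refl
  replicate-++-· (suc n) x xs =
    ↭-prep x (↭-trans (shifts (replicate n x) xs) (++⁺ˡ xs (replicate-++-· n x xs)))

module _ {A B : Set} where

  concatMap⁺ : ∀ (f : A → List B) {xs ys} → xs ↭ ys → concatMap f xs ↭ concatMap f ys
  concatMap⁺ f ↭.refl         = ↭-refl
  concatMap⁺ f (↭.prep x p)   = ++⁺ˡ (f x) (concatMap⁺ f p)
  concatMap⁺ f (↭.swap x y p) = ↭-trans (shifts (f x) (f y)) (++⁺ˡ (f y) (++⁺ˡ (f x) (concatMap⁺ f p)))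
  concatMap⁺ f (↭.trans p q)  = ↭-trans (concatMap⁺ f p) (concatMap⁺ f q)

  concatMap-· : ∀ (f : A → List B) n xs → concatMap f (n · xs) ≡ n · concatMap f xs
  concatMap-· f zero    xs = refl
  concatMap-· f (suc n) xs =
    ≡.trans (concatMap-++ f xs (n · xs)) (cong (concatMap f xs ++_) (concatMap-· f n xs))

  concatMap-split-↭ : ∀ (f g : A → List B) xs →
                      concatMap (λ x → f x ++ g x) xs ↭ concatMap f xs ++ concatMap g xs
  concatMap-split-↭ f g []       = ↭-refl
  concatMap-split-↭ f g (x ∷ xs) = begin
    (f x ++ g x) ++ concatMap (λ x → f x ++ g x) xs   ↭⟨ ++⁺ˡ (f x ++ g x) (concatMap-split-↭ f g xs) ⟩
    (f x ++ g x) ++ concatMap f xs ++ concatMap g xs  ≡⟨ ++-assoc (f x) (g x) _ ⟩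
    f x ++ g x ++ concatMap f xs ++ concatMap g xs    ↭⟨ ++⁺ˡ (f x) (shifts (g x) (concatMap f xs)) ⟩
    f x ++ concatMap f xs ++ g x ++ concatMap g xs    ≡⟨ ++-assoc (f x) _ _ ⟨
    (f x ++ concatMap f xs) ++ g x ++ concatMap g xs  ∎
    where open PermutationReasoning

module _ {A B C : Set} where

  concatMap-map≡cartesianProductWith : ∀ (f : A → B → C) xs ys →
                                       concatMap (λ x → map (f x) ys) xs ≡ cartesianProductWith f xs ys
  concatMap-map≡cartesianProductWith f []       ys = refl
  concatMap-map≡cartesianProductWith f (x ∷ xs) ys =
    cong (map (f x) ys ++_) (concatMap-map≡cartesianProductWith f xs ys)

  cartesianProductWith-∷ʳ : ∀ (f : A → B → C) xs y ys →
    cartesianProductWith f xs (y ∷ ys) ↭ map (flip f y) xs ++ cartesianProductWith f xs ys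
  cartesianProductWith-∷ʳ f []       y ys = ↭-refl
  cartesianProductWith-∷ʳ f (x ∷ xs) y ys = ↭-prep (f x y) (begin
    map (f x) ys ++ cartesianProductWith f xs (y ∷ ys)
      ↭⟨ ++⁺ˡ (map (f x) ys) (cartesianProductWith-∷ʳ f xs y ys) ⟩
    map (f x) ys ++ map (flip f y) xs ++ cartesianProductWith f xs ys
      ↭⟨ shifts (map (f x) ys) (map (flip f y) xs) ⟩
    map (flip f y) xs ++ map (f x) ys ++ cartesianProductWith f xs ys ∎)
    where open PermutationReasoning

module _ {A B C : Set} where

  cartesianProductWith-comm : ∀ (f : A → B → C) xs ys →
                              cartesianProductWith f xs ys ↭ cartesianProductWith (flip f) ys xs
  cartesianProductWith-comm f []       ys = ↭-reflexive (sym (cartesianProductWith-zeroʳ (flip f) ys))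
  cartesianProductWith-comm f (x ∷ xs) ys = ↭-trans
    (++⁺ˡ (map (f x) ys) (cartesianProductWith-comm f xs ys))
    (↭-sym (cartesianProductWith-∷ʳ (flip f) ys x xs))

iter-suc-inside : ∀ {A : Set} n (g : A → A) x → iter (suc n) g x ≡ iter n g (g x)
iter-suc-inside zero    g x = refl
iter-suc-inside (suc n) g x = cong g (iter-suc-inside n g x)

module _ {A : Set} (f : A → List A) where

  iter-concatMap-[] : ∀ a → iter a (concatMap f) [] ≡ []
  iter-concatMap-[] zero    = refl
  iter-concatMap-[] (suc a) = cong (concatMap f) (iter-concatMap-[] a)

  iter-concatMap-++ : ∀ a xs ys →
                      iter a (concatMap f) (xs ++ ys) ≡ iter a (concatMap f) xs ++ iter a (concatMap f) ys
  iter-concatMap-++ zero    xs ys = refl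
  iter-concatMap-++ (suc a) xs ys =
    ≡.trans (cong (concatMap f) (iter-concatMap-++ a xs ys)) (concatMap-++ f (iter a (concatMap f) xs) _)

  iter-concatMap : ∀ a xs → iter a (concatMap f) xs ≡ concatMap (λ x → iter a (concatMap f) [ x ]) xs
  iter-concatMap a []       = iter-concatMap-[] a
  iter-concatMap a (x ∷ xs) =
    ≡.trans (iter-concatMap-++ a [ x ] xs) (cong (iter a (concatMap f) [ x ] ++_) (iter-concatMap a xs))

  iter-concatMap⁺ : ∀ a {xs ys} → xs ↭ ys → iter a (concatMap f) xs ↭ iter a (concatMap f) ys
  iter-concatMap⁺ a {xs} {ys} p = begin
    iter a (concatMap f) xs                           ≡⟨ iter-concatMap a xs ⟩
    concatMap (λ x → iter a (concatMap f) [ x ]) xs   ↭⟨ concatMap⁺ _ p ⟩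
    concatMap (λ x → iter a (concatMap f) [ x ]) ys   ≡⟨ iter-concatMap a ys ⟨
    iter a (concatMap f) ys                           ∎
    where open PermutationReasoning

  iter-concatMap-· : ∀ a n xs → iter a (concatMap f) (n · xs) ≡ n · iter a (concatMap f) xs
  iter-concatMap-· a n xs = begin
    iter a (concatMap f) (n · xs)                           ≡⟨ iter-concatMap a (n · xs) ⟩
    concatMap (λ x → iter a (concatMap f) [ x ]) (n · xs)   ≡⟨ concatMap-· _ n xs ⟩
    n · concatMap (λ x → iter a (concatMap f) [ x ]) xs     ≡⟨ cong (n ·_) (iter-concatMap a xs) ⟨
    n · iter a (concatMap f) xs                             ∎
    where open ≡-Reasoning

-- Derivations of the free monoid

module _ {A : Set} where

  derive : (A → List (List A)) → List A → List (List A)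
  derive δ []       = []
  derive δ (c ∷ cs) = map (_++ cs) (δ c) ++ map (c ∷_) (derive δ cs)

  derive-[_] : ∀ {δ} x → derive δ [ x ] ≡ δ x
  derive-[_] {δ} x = ≡.trans (++-identityʳ _) (≡.trans (map-cong ++-identityʳ (δ x)) (map-id (δ x)))

  concatMap-derive-[_] : ∀ δ xs → concatMap (derive δ) (map [_] xs) ≡ concatMap δ xs
  concatMap-derive-[_] δ xs = ≡.trans (concatMap-map (derive δ) [_] xs) (concatMap-cong (derive-[_] {δ}) xs)

  derive-++ : ∀ δ xs ys → derive δ (xs ++ ys) ≡ map (_++ ys) (derive δ xs) ++ map (xs ++_) (derive δ ys)
  derive-++ δ []       ys = sym (map-id (derive δ ys))
  derive-++ δ (x ∷ xs) ys = begin
    map (_++ xs ++ ys) (δ x) ++ map (x ∷_) (derive δ (xs ++ ys))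
      ≡⟨ cong₂ _++_ (≡.trans (map-cong (λ u → sym (++-assoc u xs ys)) (δ x))
                             (map-∘ {g = _++ ys} {f = _++ xs} (δ x)))
                    (cong (map (x ∷_)) (derive-++ δ xs ys)) ⟩
    map (_++ ys) (map (_++ xs) (δ x)) ++ map (x ∷_) (map (_++ ys) Dxs ++ map (xs ++_) Dys)
      ≡⟨ cong (map (_++ ys) (map (_++ xs) (δ x)) ++_)
              (≡.trans (map-++ (x ∷_) (map (_++ ys) Dxs) (map (xs ++_) Dys))
                       (cong₂ _++_ (≡.trans (sym (map-∘ {g = x ∷_} {f = _++ ys} Dxs))
                                            (map-∘ {g = _++ ys} {f = x ∷_} Dxs))
                                   (sym (map-∘ {g = x ∷_} {f = xs ++_} Dys)))) ⟩
    map (_++ ys) (map (_++ xs) (δ x)) ++ map (_++ ys) (map (x ∷_) Dxs) ++ map ((x ∷ xs) ++_) Dys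
      ≡⟨ ++-assoc (map (_++ ys) (map (_++ xs) (δ x))) _ _ ⟨
    (map (_++ ys) (map (_++ xs) (δ x)) ++ map (_++ ys) (map (x ∷_) Dxs)) ++ map ((x ∷ xs) ++_) Dys
      ≡⟨ cong (_++ map ((x ∷ xs) ++_) Dys) (map-++ (_++ ys) (map (_++ xs) (δ x)) _) ⟨
    map (_++ ys) (derive δ (x ∷ xs)) ++ map ((x ∷ xs) ++_) Dys ∎
    where
    open ≡-Reasoning
    Dxs = derive δ xs
    Dys = derive δ ys

  concatMap-derive-∷ : ∀ δ δ′ c cs →
    concatMap (derive δ′) (derive δ (c ∷ cs)) ↭
      map (_++ cs) (concatMap (derive δ′) (δ c))
      ++ cartesianProductWith _++_ (δ c) (derive δ′ cs)
      ++ cartesianProductWith (flip _++_) (derive δ cs) (δ′ c)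
      ++ map (c ∷_) (concatMap (derive δ′) (derive δ cs))
  concatMap-derive-∷ δ δ′ c cs = begin
    concatMap D′ (map (_++ cs) (δ c) ++ map (c ∷_) (D cs))
      ≡⟨ concatMap-++ D′ (map (_++ cs) (δ c)) _ ⟩
    concatMap D′ (map (_++ cs) (δ c)) ++ concatMap D′ (map (c ∷_) (D cs))
      ≡⟨ cong₂ _++_ (≡.trans (concatMap-map D′ (_++ cs) (δ c)) (concatMap-cong (λ u → derive-++ δ′ u cs) (δ c)))
                    (concatMap-map D′ (c ∷_) (D cs)) ⟩
    concatMap (λ u → map (_++ cs) (D′ u) ++ map (u ++_) (D′ cs)) (δ c)
      ++ concatMap (λ h → map (_++ h) (δ′ c) ++ map (c ∷_) (D′ h)) (D cs)
      ↭⟨ ++⁺ (concatMap-split-↭ (map (_++ cs) ∘ D′) (λ u → map (u ++_) (D′ cs)) (δ c))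
             (concatMap-split-↭ (λ h → map (_++ h) (δ′ c)) (map (c ∷_) ∘ D′) (D cs)) ⟩
    (concatMap (map (_++ cs) ∘ D′) (δ c) ++ concatMap (λ u → map (u ++_) (D′ cs)) (δ c))
      ++ concatMap (λ h → map (_++ h) (δ′ c)) (D cs) ++ concatMap (map (c ∷_) ∘ D′) (D cs)
      ≡⟨ cong₂ _++_
           (cong₂ _++_ (sym (map-concatMap (_++ cs) D′ (δ c)))
                       (concatMap-map≡cartesianProductWith _++_ (δ c) (D′ cs)))
           (cong₂ _++_ (concatMap-map≡cartesianProductWith (flip _++_) (D cs) (δ′ c))
                       (sym (map-concatMap (c ∷_) D′ (D cs)))) ⟩
    (map (_++ cs) (concatMap D′ (δ c)) ++ cartesianProductWith _++_ (δ c) (D′ cs))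
      ++ cartesianProductWith (flip _++_) (D cs) (δ′ c) ++ map (c ∷_) (concatMap D′ (D cs))
      ≡⟨ ++-assoc (map (_++ cs) (concatMap D′ (δ c))) _ _ ⟩
    _ ∎
    where
    open PermutationReasoning
    D  = derive δ
    D′ = derive δ′

  private
    open import Algebra.Solver.CommutativeMonoid (++-commutativeMonoid {A = List A})
    open import Data.Vec using ([]; _∷_)
    open import Data.Fin using (zero; suc)

    ++-rearrange-↭ : ∀ (r a x y r′ b : List (List A)) →
                     (r ++ a) ++ x ++ y ++ r′ ++ b ↭ (r ++ r′) ++ a ++ y ++ x ++ b
    ++-rearrange-↭ r a x y r′ b =
      prove 6 ((R ⊕ A′) ⊕ X ⊕ Y ⊕ R′ ⊕ B) ((R ⊕ R′) ⊕ A′ ⊕ Y ⊕ X ⊕ B) (r ∷ a ∷ x ∷ y ∷ r′ ∷ b ∷ [])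
      where
      R  = var zero
      A′ = var (suc zero)
      X  = var (suc (suc zero))
      Y  = var (suc (suc (suc zero)))
      R′ = var (suc (suc (suc (suc zero))))
      B  = var (suc (suc (suc (suc (suc zero)))))

  derive-commutator : ∀ δ₁ δ₂ ρ {cs} →
    All (λ c → concatMap (derive δ₂) (δ₁ c) ↭ ρ c ++ concatMap (derive δ₁) (δ₂ c)) cs →
    concatMap (derive δ₂) (derive δ₁ cs) ↭ derive ρ cs ++ concatMap (derive δ₁) (derive δ₂ cs)
  derive-commutator δ₁ δ₂ ρ {[]}     []       = ↭-refl
  derive-commutator δ₁ δ₂ ρ {c ∷ cs} (h ∷ hs) = begin
    concatMap D₂ (D₁ (c ∷ cs))
      ↭⟨ concatMap-derive-∷ δ₁ δ₂ c cs ⟩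
    map (_++ cs) (concatMap D₂ (δ₁ c)) ++ X ++ Y ++ map (c ∷_) (concatMap D₂ (D₁ cs))
      ↭⟨ ++⁺ (map-↭-++ (_++ cs) (ρ c) h)
             (++⁺ˡ X (++⁺ˡ Y (map-↭-++ (c ∷_) (derive ρ cs) (derive-commutator δ₁ δ₂ ρ hs)))) ⟩
    (map (_++ cs) (ρ c) ++ map (_++ cs) (concatMap D₁ (δ₂ c))) ++ X ++ Y
      ++ map (c ∷_) (derive ρ cs) ++ map (c ∷_) (concatMap D₁ (D₂ cs))
      ↭⟨ ++-rearrange-↭ (map (_++ cs) (ρ c)) (map (_++ cs) (concatMap D₁ (δ₂ c))) X Y
                        (map (c ∷_) (derive ρ cs)) (map (c ∷_) (concatMap D₁ (D₂ cs))) ⟩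
    derive ρ (c ∷ cs) ++ map (_++ cs) (concatMap D₁ (δ₂ c)) ++ Y ++ X ++ map (c ∷_) (concatMap D₁ (D₂ cs))
      ↭⟨ ++⁺ˡ (derive ρ (c ∷ cs)) (++⁺ˡ (map (_++ cs) (concatMap D₁ (δ₂ c)))
           (++⁺ (cartesianProductWith-comm (flip _++_) (D₁ cs) (δ₂ c))
                (++⁺ʳ _ (cartesianProductWith-comm _++_ (δ₁ c) (D₂ cs))))) ⟩
    derive ρ (c ∷ cs) ++ map (_++ cs) (concatMap D₁ (δ₂ c)) ++ cartesianProductWith _++_ (δ₂ c) (D₁ cs)
      ++ cartesianProductWith (flip _++_) (D₂ cs) (δ₁ c) ++ map (c ∷_) (concatMap D₁ (D₂ cs))
      ↭⟨ ++⁺ˡ (derive ρ (c ∷ cs)) (concatMap-derive-∷ δ₂ δ₁ c cs) ⟨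
    derive ρ (c ∷ cs) ++ concatMap D₁ (D₂ (c ∷ cs)) ∎
    where
    open PermutationReasoning
    D₁ = derive δ₁
    D₂ = derive δ₂
    X  = cartesianProductWith _++_ (δ₁ c) (D₂ cs)
    Y  = cartesianProductWith (flip _++_) (D₁ cs) (δ₂ c)
    map-↭-++ : ∀ (f : List A → List A) ys {xs zs} → xs ↭ ys ++ zs → map f xs ↭ map f ys ++ map f zs
    map-↭-++ f ys p = ↭-trans (map⁺ f p) (↭-reflexive (map-++ f ys _))

module _ (S : Setoid 0ℓ 0ℓ) where
  open Setoid S using (_≈_) renaming (Carrier to A; refl to ≈-refl; sym to ≈-sym)
  open PermutationSetoid S using ()
    renaming (_↭_ to _↭₁_; ↭-setoid to ↭₁-setoid; ↭-refl to ↭₁-refl; ↭-sym to ↭₁-sym; ↭-trans to ↭₁-trans)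
  open PermutationSetoid ↭₁-setoid using ()
    renaming (_↭_ to _↭₂_; ↭-refl to ↭₂-refl; ↭-sym to ↭₂-sym; ↭-trans to ↭₂-trans; ↭-reflexive to ↭₂-reflexive)
  private
    module P₁ = PermutationSetoidProperties S
    module P₂ = PermutationSetoidProperties ↭₁-setoid

  module _ (f : A → List A) (f-resp : ∀ {a b} → a ≈ b → f a ↭₁ f b) where

    concatMap-resp-≋ : ∀ {xs ys} → Pointwise _≈_ xs ys → concatMap f xs ↭₁ concatMap f ys
    concatMap-resp-≋ []       = ↭₁-refl
    concatMap-resp-≋ (e ∷ es) = P₁.++⁺ (f-resp e) (concatMap-resp-≋ es)

    concatMap-resp : ∀ {xs ys} → xs ↭₁ ys → concatMap f xs ↭₁ concatMap f ys
    concatMap-resp (Perm.refl xs≋ys)                 = concatMap-resp-≋ xs≋ys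
    concatMap-resp (Perm.prep e p)                   = P₁.++⁺ (f-resp e) (concatMap-resp p)
    concatMap-resp (Perm.swap {x = x} {y = y} e₁ e₂ p) =
      ↭₁-trans (P₁.shifts (f x) (f y)) (P₁.++⁺ (f-resp e₂) (P₁.++⁺ (f-resp e₁) (concatMap-resp p)))
    concatMap-resp (Perm.trans p q)                  = ↭₁-trans (concatMap-resp p) (concatMap-resp q)

  map-resp : ∀ {f g : List A → List A} → (∀ {u v} → u ↭₁ v → f u ↭₁ f v) → (∀ u → f u ↭₁ g u) →
             ∀ {U V} → U ↭₂ V → map f U ↭₂ map g V
  map-resp {f} {g} f-resp f≈g U↭V =
    ↭₂-trans (P₂.map⁺ ↭₁-setoid f-resp U↭V) (Perm.refl (Pointwise.map⁺ f g (Pointwise.refl (f≈g _))))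

  module _ (δ : A → List (List A)) where

    -- Recording the compatibility of δ at each matched pair, instead of assuming it
    -- everywhere, lets derive-resp be used inside the induction that proves it.
    _≈ᵟ_ : A → A → Set
    a ≈ᵟ b = a ≈ b × δ a ↭₂ δ b

    private
      forget : ∀ {xs ys} → Perm.Permutation _≈ᵟ_ xs ys → xs ↭₁ ys
      forget = Perm.map proj₁

      map-shift : ∀ {d d′ cs ds U U′} → d ≈ d′ → cs ↭₁ ds → U ↭₂ U′ →
                  map (_++ d ∷ cs) U ↭₂ map (d′ ∷_) (map (_++ ds) U′)
      map-shift {d} {d′} {cs} {ds} {U′ = U′} d≈d′ cs↭ds U↭U′ = ↭₂-trans
        (map-resp (P₁.++⁺ʳ (d ∷ cs))
                  (λ u → ↭₁-trans (P₁.shift d≈d′ u cs) (Perm.prep ≈-refl (P₁.++⁺ˡ u cs↭ds))) U↭U′)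
        (↭₂-reflexive (map-∘ {g = d′ ∷_} {f = _++ ds} U′))

    derive-∷-resp : ∀ {c d cs ds} → c ≈ᵟ d → cs ↭₁ ds → derive δ cs ↭₂ derive δ ds →
                    derive δ (c ∷ cs) ↭₂ derive δ (d ∷ ds)
    derive-∷-resp (c≈d , δc↭δd) cs↭ds ∂cs↭∂ds = P₂.++⁺
      (map-resp (P₁.++⁺ʳ _) (λ u → P₁.++⁺ˡ u cs↭ds) δc↭δd)
      (map-resp (Perm.prep ≈-refl) (λ _ → Perm.prep c≈d ↭₁-refl) ∂cs↭∂ds)

    derive-swap-resp : ∀ {c c′ d d′ cs ds} → c ≈ᵟ c′ → d ≈ᵟ d′ → cs ↭₁ ds → derive δ cs ↭₂ derive δ ds →
                       derive δ (c ∷ d ∷ cs) ↭₂ derive δ (d′ ∷ c′ ∷ ds)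
    derive-swap-resp {c} {c′} {d} {d′} {cs} {ds} (c≈c′ , δc) (d≈d′ , δd) cs↭ds ∂cs↭∂ds = begin
      map (_++ d ∷ cs) (δ c) ++ map (c ∷_) (map (_++ cs) (δ d) ++ map (d ∷_) (derive δ cs))
        ≡⟨ cong (map (_++ d ∷ cs) (δ c) ++_) (map-++ (c ∷_) (map (_++ cs) (δ d)) _) ⟩
      map (_++ d ∷ cs) (δ c) ++ map (c ∷_) (map (_++ cs) (δ d)) ++ map (c ∷_) (map (d ∷_) (derive δ cs))
        ↭⟨ P₂.++⁺ (map-shift d≈d′ cs↭ds δc)
                  (P₂.++⁺ (↭₂-sym (map-shift (≈-sym c≈c′) (↭₁-sym cs↭ds) (↭₂-sym δd))) two-heads) ⟩
      map (d′ ∷_) (map (_++ ds) (δ c′)) ++ map (_++ c′ ∷ ds) (δ d′) ++ map (d′ ∷_) (map (c′ ∷_) (derive δ ds))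
        ↭⟨ P₂.shifts (map (d′ ∷_) (map (_++ ds) (δ c′))) (map (_++ c′ ∷ ds) (δ d′)) ⟩
      map (_++ c′ ∷ ds) (δ d′) ++ map (d′ ∷_) (map (_++ ds) (δ c′)) ++ map (d′ ∷_) (map (c′ ∷_) (derive δ ds))
        ≡⟨ cong (map (_++ c′ ∷ ds) (δ d′) ++_) (map-++ (d′ ∷_) (map (_++ ds) (δ c′)) _) ⟨
      derive δ (d′ ∷ c′ ∷ ds) ∎
      where
      open PermutationSetoid.PermutationReasoning ↭₁-setoid
      two-heads : map (c ∷_) (map (d ∷_) (derive δ cs)) ↭₂ map (d′ ∷_) (map (c′ ∷_) (derive δ ds))
      two-heads = ↭₂-trans (↭₂-reflexive (sym (map-∘ (derive δ cs))))
        (↭₂-trans (map-resp (Perm.prep ≈-refl ∘ Perm.prep ≈-refl) (λ _ → Perm.swap c≈c′ d≈d′ ↭₁-refl) ∂cs↭∂ds)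
                  (↭₂-reflexive (map-∘ (derive δ ds))))

    derive-resp-≋ : ∀ {cs ds} → Pointwise _≈ᵟ_ cs ds → derive δ cs ↭₂ derive δ ds
    derive-resp-≋ []       = ↭₂-refl
    derive-resp-≋ (e ∷ es) = derive-∷-resp e (Perm.refl (Pointwise.map proj₁ es)) (derive-resp-≋ es)

    derive-resp : ∀ {cs ds} → Perm.Permutation _≈ᵟ_ cs ds → derive δ cs ↭₂ derive δ ds
    derive-resp (Perm.refl cs≋ds)   = derive-resp-≋ cs≋ds
    derive-resp (Perm.prep e p)     = derive-∷-resp e (forget p) (derive-resp p)
    derive-resp (Perm.swap e₁ e₂ p) = derive-swap-resp e₁ e₂ (forget p) (derive-resp p)
    derive-resp (Perm.trans p q)    = ↭₂-trans (derive-resp p) (derive-resp q)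

mutual
  ≅-refl : ∀ {t} → t ≅ t
  ≅-refl {node cs} = node (Perm.refl ≅-refl-≋)

  ≅-refl-≋ : ∀ {cs} → Pointwise _≅_ cs cs
  ≅-refl-≋ {[]}     = []
  ≅-refl-≋ {c ∷ cs} = ≅-refl ∷ ≅-refl-≋

mutual
  ≅-sym : ∀ {s t} → s ≅ t → t ≅ s
  ≅-sym (node p) = node (≅-sym-↭ p)

  ≅-sym-↭ : ∀ {cs ds} → Perm.Permutation _≅_ cs ds → Perm.Permutation _≅_ ds cs
  ≅-sym-↭ (Perm.refl cs≋ds)   = Perm.refl (≅-sym-≋ cs≋ds)
  ≅-sym-↭ (Perm.prep e p)     = Perm.prep (≅-sym e) (≅-sym-↭ p)
  ≅-sym-↭ (Perm.swap e₁ e₂ p) = Perm.swap (≅-sym e₂) (≅-sym e₁) (≅-sym-↭ p)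
  ≅-sym-↭ (Perm.trans p q)    = Perm.trans (≅-sym-↭ q) (≅-sym-↭ p)

  ≅-sym-≋ : ∀ {cs ds} → Pointwise _≅_ cs ds → Pointwise _≅_ ds cs
  ≅-sym-≋ []       = []
  ≅-sym-≋ (e ∷ es) = ≅-sym e ∷ ≅-sym-≋ es

≅-trans : ∀ {s t u} → s ≅ t → t ≅ u → s ≅ u
≅-trans (node p) (node q) = node (Perm.trans p q)

≅-setoid : Setoid 0ℓ 0ℓ
≅-setoid = record
  { Carrier       = PTree
  ; _≈_           = _≅_
  ; isEquivalence = record { refl = ≅-refl ; sym = ≅-sym ; trans = ≅-trans }
  }

open PermutationSetoid ≅-setoid using ()
  renaming (_↭_ to _↭ᵢ_; ↭-setoid to ↭ᵢ-setoid; ↭-sym to ↭ᵢ-sym)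
open PermutationSetoid ↭ᵢ-setoid using ()
  renaming (_↭_ to _↭ᵢᵢ_; ↭-refl to ↭ᵢᵢ-refl)
private
  module Pᵢ  = PermutationSetoidProperties ≅-setoid
  module Pᵢᵢ = PermutationSetoidProperties ↭ᵢ-setoid

↭⇒↭ᵢ : ∀ {xs ys} → xs ↭ ys → xs ↭ᵢ ys
↭⇒↭ᵢ = ↭.↭⇒↭ₛ′ (Setoid.isEquivalence ≅-setoid)

count-cons : ∀ {t x y xs ys} → x ≅ y → (∀ {c} → Count t xs c → Count t ys c) →
             ∀ {c} → Count t (x ∷ xs) c → Count t (y ∷ ys) c
count-cons x≅y rest (hit x≅t k)  = hit (≅-trans (≅-sym x≅y) x≅t) (rest k)
count-cons x≅y rest (miss x≇t k) = miss (x≇t ∘ ≅-trans x≅y) (rest k)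

count-swap : ∀ {t x y xs c} → Count t (x ∷ y ∷ xs) c → Count t (y ∷ x ∷ xs) c
count-swap (hit p (hit q k))   = hit q (hit p k)
count-swap (hit p (miss q k))  = miss q (hit p k)
count-swap (miss p (hit q k))  = hit q (miss p k)
count-swap (miss p (miss q k)) = miss q (miss p k)

count-resp-≋ : ∀ {t xs ys} → Pointwise _≅_ xs ys → ∀ {c} → Count t xs c → Count t ys c
count-resp-≋ []       []  = []
count-resp-≋ (e ∷ es) k   = count-cons e (count-resp-≋ es) k

count-resp : ∀ {t xs ys} → xs ↭ᵢ ys → ∀ {c} → Count t xs c → Count t ys c
count-resp (Perm.refl xs≋ys)   = count-resp-≋ xs≋ys
count-resp (Perm.prep e p)     = count-cons e (count-resp p)
count-resp (Perm.swap e₁ e₂ p) = count-cons e₂ (count-cons e₁ (count-resp p)) ∘ count-swap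
count-resp (Perm.trans p q)    = count-resp q ∘ count-resp p

count-unique : ∀ {t xs c d} → Count t xs c → Count t xs d → c ≡ d
count-unique []           []           = refl
count-unique (hit _ k)    (hit _ l)    = cong suc (count-unique k l)
count-unique (hit x≅t _)  (miss x≇t _) = ⊥-elim (x≇t x≅t)
count-unique (miss x≇t _) (hit x≅t _)  = ⊥-elim (x≇t x≅t)
count-unique (miss _ k)   (miss _ l)   = count-unique k l

count-++ : ∀ {t xs ys c d} → Count t xs c → Count t ys d → Count t (xs ++ ys) (c + d)
count-++ []         l = l
count-++ (hit p k)  l = hit p (count-++ k l)
count-++ (miss p k) l = miss p (count-++ k l)

count-· : ∀ {t xs c} n → Count t xs c → Count t (n · xs) (n * c)
count-· zero    k = []
count-· (suc n) k = count-++ k (count-· n k)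

-- Grafting and pruning as derivations

graftChild : PTree → List (List PTree)
graftChild c = map [_] (grafts c)

-- A terminal child is deleted outright, which is why derivations replace a letter by
-- words rather than by letters.
pruneChild : PTree → List (List PTree)
pruneChild (node [])       = [ [] ]
pruneChild (node (d ∷ ds)) = map [_] (prunes (node (d ∷ ds)))

graftsIn-derive : ∀ cs → graftsIn cs ≡ derive graftChild cs
graftsIn-derive []       = refl
graftsIn-derive (c ∷ cs) = cong₂ _++_ (map-∘ (grafts c)) (cong (map (c ∷_)) (graftsIn-derive cs))

prunesIn-derive : ∀ cs → prunesIn cs ≡ derive pruneChild cs
prunesIn-derive []                   = refl
prunesIn-derive (node [] ∷ cs)       = cong (cs ∷_) (cong (map (• ∷_)) (prunesIn-derive cs))
prunesIn-derive (node (d ∷ ds) ∷ cs) =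
  cong₂ _++_ (map-∘ (prunes (node (d ∷ ds)))) (cong (map (node (d ∷ ds) ∷_)) (prunesIn-derive cs))

mutual
  prunes-resp : ∀ {s t} → s ≅ t → prunes s ↭ᵢ prunes t
  prunes-resp (node p) = Pᵢᵢ.map⁺ ≅-setoid node (prunesIn-resp p)

  prunesIn-resp : ∀ {cs ds} → cs ↭ᵢ ds → prunesIn cs ↭ᵢᵢ prunesIn ds
  prunesIn-resp {cs} {ds} p rewrite prunesIn-derive cs | prunesIn-derive ds =
    derive-resp ≅-setoid pruneChild (pruneChild-annotate p)

  pruneChild-resp : ∀ {s t} → s ≅ t → pruneChild s ↭ᵢᵢ pruneChild t
  pruneChild-resp {node []}      {node []}      _        = ↭ᵢᵢ-refl
  pruneChild-resp {node []}      {node (_ ∷ _)} (node p) = ⊥-elim (Pᵢ.¬x∷xs↭[] (↭ᵢ-sym p))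
  pruneChild-resp {node (_ ∷ _)} {node []}      (node p) = ⊥-elim (Pᵢ.¬x∷xs↭[] p)
  pruneChild-resp {node (_ ∷ _)} {node (_ ∷ _)} e        =
    Pᵢ.map⁺ ↭ᵢ-setoid (λ s≅t → Perm.prep s≅t (Perm.refl [])) (prunes-resp e)

  pruneChild-annotate : ∀ {cs ds} → cs ↭ᵢ ds → Perm.Permutation (_≈ᵟ_ ≅-setoid pruneChild) cs ds
  pruneChild-annotate (Perm.refl cs≋ds)   = Perm.refl (pruneChild-annotate-≋ cs≋ds)
  pruneChild-annotate (Perm.prep e p)     = Perm.prep (e , pruneChild-resp e) (pruneChild-annotate p)
  pruneChild-annotate (Perm.swap e₁ e₂ p) =
    Perm.swap (e₁ , pruneChild-resp e₁) (e₂ , pruneChild-resp e₂) (pruneChild-annotate p)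
  pruneChild-annotate (Perm.trans p q)    = Perm.trans (pruneChild-annotate p) (pruneChild-annotate q)

  pruneChild-annotate-≋ : ∀ {cs ds} → Pointwise _≅_ cs ds → Pointwise (_≈ᵟ_ ≅-setoid pruneChild) cs ds
  pruneChild-annotate-≋ []       = []
  pruneChild-annotate-≋ (e ∷ es) = (e , pruneChild-resp e) ∷ pruneChild-annotate-≋ es

iter-𝔓-resp : ∀ a {xs ys} → xs ↭ᵢ ys → iter a 𝔓 xs ↭ᵢ iter a 𝔓 ys
iter-𝔓-resp zero    p = p
iter-𝔓-resp (suc a) p = concatMap-resp ≅-setoid prunes prunes-resp (iter-𝔓-resp a p)

-- The commutator of pruning and grafting

grafts-nonLeaf : ∀ t → All (λ g → pruneChild g ≡ map [_] (prunes g)) (grafts t)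
grafts-nonLeaf (node cs) = refl ∷ All.map⁺ (graftsIn-nonEmpty cs)
  where
  graftsIn-nonEmpty : ∀ cs → All (λ ds → pruneChild (node ds) ≡ map [_] (prunes (node ds))) (graftsIn cs)
  graftsIn-nonEmpty []       = []
  graftsIn-nonEmpty (c ∷ cs) =
    All.++⁺ (All.map⁺ {f = _∷ cs} (All.tabulate {xs = grafts c} λ _ → refl))
            (All.map⁺ {f = c ∷_} (All.tabulate {xs = graftsIn cs} λ _ → refl))

pruneChild-after-graftChild : ∀ t → concatMap (derive pruneChild) (graftChild t) ≡ map [_] (𝔓 (grafts t))
pruneChild-after-graftChild t = begin
  concatMap (derive pruneChild) (map [_] (grafts t))   ≡⟨ concatMap-derive-[_] pruneChild (grafts t) ⟩
  concatMap pruneChild (grafts t)                      ≡⟨ cong concat (map-cong-local (grafts-nonLeaf t)) ⟩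
  concatMap (map [_] ∘ prunes) (grafts t)              ≡⟨ map-concatMap [_] prunes (grafts t) ⟨
  map [_] (𝔓 (grafts t))                               ∎
  where open ≡-Reasoning

graftChild-after-pruneChild : ∀ t → concatMap (derive graftChild) (pruneChild t) ≡ map [_] (𝔑 (prunes t))
graftChild-after-pruneChild (node [])       = refl
graftChild-after-pruneChild (node (d ∷ ds)) = ≡.trans
  (concatMap-derive-[_] graftChild (prunes (node (d ∷ ds))))
  (sym (map-concatMap [_] grafts (prunes (node (d ∷ ds)))))

sizeChild : PTree → List (List PTree)
sizeChild c = replicate (size c) [ c ]

derive-sizeChild : ∀ cs → derive sizeChild cs ≡ replicate (sizes cs) cs
derive-sizeChild []       = refl
derive-sizeChild (c ∷ cs) = begin
  map (_++ cs) (replicate (size c) [ c ]) ++ map (c ∷_) (derive sizeChild cs)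
    ≡⟨ cong₂ _++_ (map-replicate (_++ cs) (size c) [ c ]) (cong (map (c ∷_)) (derive-sizeChild cs)) ⟩
  replicate (size c) (c ∷ cs) ++ map (c ∷_) (replicate (sizes cs) cs)
    ≡⟨ cong (replicate (size c) (c ∷ cs) ++_) (map-replicate (c ∷_) (sizes cs) cs) ⟩
  replicate (size c) (c ∷ cs) ++ replicate (sizes cs) (c ∷ cs)
    ≡⟨ replicate-+ (size c) (sizes cs) (c ∷ cs) ⟨
  replicate (sizes (c ∷ cs)) (c ∷ cs) ∎
  where open ≡-Reasoning

ChildCommutator : PTree → Set
ChildCommutator c =
  concatMap (derive pruneChild) (graftChild c) ↭ sizeChild c ++ concatMap (derive graftChild) (pruneChild c)

prunesIn-graftsIn : ∀ {cs} → All ChildCommutator cs →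
  concatMap prunesIn (graftsIn cs) ↭ replicate (sizes cs) cs ++ concatMap graftsIn (prunesIn cs)
prunesIn-graftsIn {cs} hyps = begin
  concatMap prunesIn (graftsIn cs)
    ≡⟨ ≡.trans (cong (concatMap prunesIn) (graftsIn-derive cs))
               (concatMap-cong prunesIn-derive (derive graftChild cs)) ⟩
  concatMap (derive pruneChild) (derive graftChild cs)
    ↭⟨ derive-commutator graftChild pruneChild sizeChild hyps ⟩
  derive sizeChild cs ++ concatMap (derive graftChild) (derive pruneChild cs)
    ≡⟨ cong₂ _++_ (derive-sizeChild cs)
         (sym (≡.trans (cong (concatMap graftsIn) (prunesIn-derive cs))
                       (concatMap-cong graftsIn-derive (derive pruneChild cs)))) ⟩
  replicate (sizes cs) cs ++ concatMap graftsIn (prunesIn cs) ∎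
  where open PermutationReasoning

mutual
  𝔓-grafts : ∀ t → 𝔓 (grafts t) ↭ replicate (size t) t ++ 𝔑 (prunes t)
  𝔓-grafts (node cs) = ↭-prep (node cs) (begin
    M₁ ++ 𝔓 (map node (graftsIn cs))
      ≡⟨ cong (M₁ ++_) (≡.trans (concatMap-map prunes node (graftsIn cs))
                                (sym (map-concatMap node prunesIn (graftsIn cs)))) ⟩
    M₁ ++ map node (concatMap prunesIn (graftsIn cs))
      ↭⟨ ++⁺ˡ M₁ (map⁺ node (prunesIn-graftsIn (childCommutators cs))) ⟩
    M₁ ++ map node (replicate s cs ++ concatMap graftsIn Q)
      ≡⟨ cong (M₁ ++_) (≡.trans (map-++ node (replicate s cs) _) (cong (_++ M₂) (map-replicate node s cs))) ⟩
    M₁ ++ replicate s (node cs) ++ M₂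
      ↭⟨ shifts M₁ (replicate s (node cs)) ⟩
    replicate s (node cs) ++ M₁ ++ M₂
      ≡⟨ cong (replicate s (node cs) ++_) (cong₂ _++_
           (≡.trans (sym (map-∘ Q)) (≡.trans (sym (concatMap-pure _)) (concatMap-map [_] graftRoot Q)))
           (map-concatMap node graftsIn Q)) ⟩
    replicate s (node cs) ++ concatMap ([_] ∘ graftRoot) Q ++ concatMap (map node ∘ graftsIn) Q
      ↭⟨ ++⁺ˡ (replicate s (node cs)) (concatMap-split-↭ ([_] ∘ graftRoot) (map node ∘ graftsIn) Q) ⟨
    replicate s (node cs) ++ concatMap (grafts ∘ node) Q
      ≡⟨ cong (replicate s (node cs) ++_) (concatMap-map grafts node Q) ⟨
    replicate s (node cs) ++ 𝔑 (prunes (node cs)) ∎)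
    where
    open PermutationReasoning
    Q  = prunesIn cs
    s  = sizes cs
    M₁ = map node (map (• ∷_) Q)
    M₂ = map node (concatMap graftsIn Q)
    graftRoot : List PTree → PTree
    graftRoot q = node (• ∷ q)

  childCommutators : ∀ cs → All ChildCommutator cs
  childCommutators []       = []
  childCommutators (c ∷ cs) = childCommutator c ∷ childCommutators cs

  childCommutator : ∀ c → ChildCommutator c
  childCommutator c = begin
    concatMap (derive pruneChild) (graftChild c)        ≡⟨ pruneChild-after-graftChild c ⟩
    map [_] (𝔓 (grafts c))                              ↭⟨ map⁺ [_] (𝔓-grafts c) ⟩
    map [_] (replicate (size c) c ++ 𝔑 (prunes c))      ≡⟨ map-++ [_] (replicate (size c) c) _ ⟩
    map [_] (replicate (size c) c) ++ map [_] (𝔑 (prunes c))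
      ≡⟨ cong₂ _++_ (map-replicate [_] (size c) c) (sym (graftChild-after-pruneChild c)) ⟩
    sizeChild c ++ concatMap (derive graftChild) (pruneChild c) ∎
    where open PermutationReasoning

𝔇 : List PTree → List PTree
𝔇 = concatMap (λ t → replicate (size t) t)

𝔓𝔑-commutator : ∀ ts → 𝔓 (𝔑 ts) ↭ 𝔇 ts ++ 𝔑 (𝔓 ts)
𝔓𝔑-commutator []       = ↭-refl
𝔓𝔑-commutator (t ∷ ts) = begin
  𝔓 (grafts t ++ 𝔑 ts)
    ≡⟨ concatMap-++ prunes (grafts t) (𝔑 ts) ⟩
  𝔓 (grafts t) ++ 𝔓 (𝔑 ts)
    ↭⟨ ++⁺ (𝔓-grafts t) (𝔓𝔑-commutator ts) ⟩
  (replicate (size t) t ++ 𝔑 (prunes t)) ++ 𝔇 ts ++ 𝔑 (𝔓 ts)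
    ↭⟨ interchange (replicate (size t) t) _ _ _ ⟩
  𝔇 (t ∷ ts) ++ 𝔑 (prunes t) ++ 𝔑 (𝔓 ts)
    ≡⟨ cong (𝔇 (t ∷ ts) ++_) (concatMap-++ grafts (prunes t) (𝔓 ts)) ⟨
  𝔇 (t ∷ ts) ++ 𝔑 (𝔓 (t ∷ ts)) ∎
  where
  open PermutationReasoning
  open import Algebra.Properties.CommutativeSemigroup
    (CommutativeMonoid.commutativeSemigroup (++-commutativeMonoid {A = PTree})) using (interchange)

𝔇-homogeneous : ∀ {s ts} → All (λ t → size t ≡ s) ts → 𝔇 ts ↭ s · ts
𝔇-homogeneous {s} []                   = ↭-reflexive (sym (·-[] s))
𝔇-homogeneous {s} {t ∷ ts} (refl ∷ ps) =
  ↭-trans (++⁺ˡ (replicate s t) (𝔇-homogeneous ps)) (replicate-++-· s t ts)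

mutual
  grafts-size : ∀ t → All (λ g → size g ≡ suc (size t)) (grafts t)
  grafts-size (node cs) = refl ∷ All.map⁺ (All.map (cong suc) (graftsIn-sizes cs))

  graftsIn-sizes : ∀ cs → All (λ ds → sizes ds ≡ suc (sizes cs)) (graftsIn cs)
  graftsIn-sizes []       = []
  graftsIn-sizes (c ∷ cs) = All.++⁺
    (All.map⁺ (All.map (cong (_+ sizes cs)) (grafts-size c)))
    (All.map⁺ (All.map (λ e → ≡.trans (cong (size c +_) e) (+-suc (size c) (sizes cs))) (graftsIn-sizes cs)))

𝔑-size : ∀ {s ts} → All (λ t → size t ≡ s) ts → All (λ t → size t ≡ suc s) (𝔑 ts)
𝔑-size {ts = []}     []          = []
𝔑-size {ts = t ∷ ts} (refl ∷ ps) = All.++⁺ (grafts-size t) (𝔑-size ps)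

𝔑• : ℕ → List PTree
𝔑• j = iter j 𝔑 [ • ]

𝔑•-size : ∀ j → All (λ t → size t ≡ suc j) (𝔑• j)
𝔑•-size zero    = refl ∷ []
𝔑•-size (suc j) = 𝔑-size (𝔑•-size j)

mutual
  𝔓-𝔑• : ∀ j → 𝔓 (𝔑• (suc j)) ↭ suc (suc j) C 2 · 𝔑• j
  𝔓-𝔑• j = begin
    𝔓 (𝔑 (𝔑• j))                          ↭⟨ 𝔓𝔑-commutator (𝔑• j) ⟩
    𝔇 (𝔑• j) ++ 𝔑 (𝔓 (𝔑• j))              ↭⟨ ++⁺ (𝔇-homogeneous (𝔑•-size j)) (𝔑-𝔓-𝔑• j) ⟩
    suc j · 𝔑• j ++ suc j C 2 · 𝔑• j      ≡⟨ ·-+ (suc j) (suc j C 2) (𝔑• j) ⟨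
    (suc j + suc j C 2) · 𝔑• j            ≡⟨ cong (_· 𝔑• j) pascal ⟩
    suc (suc j) C 2 · 𝔑• j                ∎
    where
    open PermutationReasoning
    pascal : suc j + suc j C 2 ≡ suc (suc j) C 2
    pascal = ≡.trans (cong (_+ suc j C 2) (sym (nC1≡n (suc j)))) (nCk+nC[k+1]≡[n+1]C[k+1] (suc j) 1)

  -- The base case holds by computation: 𝔓 • is empty and 1 C 2 = 0.
  𝔑-𝔓-𝔑• : ∀ j → 𝔑 (𝔓 (𝔑• j)) ↭ suc j C 2 · 𝔑• j
  𝔑-𝔓-𝔑• zero    = ↭-refl
  𝔑-𝔓-𝔑• (suc j) =
    ↭-trans (concatMap⁺ grafts (𝔓-𝔑• j)) (↭-reflexive (concatMap-· grafts (suc (suc j) C 2) (𝔑• j)))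

𝔓ᵃ-𝔑• : ∀ k a → iter a 𝔓 (𝔑• (k + a)) ↭ prodC k a · 𝔑• k
𝔓ᵃ-𝔑• k zero rewrite +-identityʳ k = ↭-reflexive (sym (++-identityʳ (𝔑• k)))
𝔓ᵃ-𝔑• k (suc a) = begin
  iter (suc a) 𝔓 (𝔑• (k + suc a))      ≡⟨ cong (iter (suc a) 𝔓 ∘ 𝔑•) (+-suc k a) ⟩
  iter (suc a) 𝔓 (𝔑• (suc (k + a)))    ≡⟨ iter-suc-inside a 𝔓 _ ⟩
  iter a 𝔓 (𝔓 (𝔑• (suc (k + a))))      ↭⟨ iter-concatMap⁺ prunes a (𝔓-𝔑• (k + a)) ⟩
  iter a 𝔓 (c · 𝔑• (k + a))            ≡⟨ iter-concatMap-· prunes a c (𝔑• (k + a)) ⟩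
  c · iter a 𝔓 (𝔑• (k + a))            ↭⟨ ·⁺ c (𝔓ᵃ-𝔑• k a) ⟩
  c · (prodC k a · 𝔑• k)               ≡⟨ ·-* c (prodC k a) (𝔑• k) ⟩
  (c * prodC k a) · 𝔑• k               ≡⟨ cong (_· 𝔑• k) (≡.trans (*-comm c (prodC k a))
                                                                  (cong (λ n → prodC k a * (n C 2)) index)) ⟩
  prodC k (suc a) · 𝔑• k               ∎
  where
  open PermutationReasoning
  c = suc (suc (k + a)) C 2
  index : suc (suc (k + a)) ≡ k + (a + 2)
  index = sym (≡.trans (sym (+-assoc k a 2)) (+-comm (k + a) 2))

Counts : List PTree → List PTree → List ℕ → Set
Counts Z = Pointwise (λ t c → Count t Z c)

weightedSum : (PTree → ℕ) → List PTree → List ℕ → ℕ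
weightedSum w L cs = sum (zipWith (λ t c → w t * c) L cs)

weightedSum-map : ∀ w n L → weightedSum w L (map n L) ≡ sum (map (λ t → w t * n t) L)
weightedSum-map w n []      = refl
weightedSum-map w n (t ∷ L) = cong (w t * n t +_) (weightedSum-map w n L)

weightedSum-[] : ∀ {w L cs} → Counts [] L cs → weightedSum w L cs ≡ 0
weightedSum-[]             []        = refl
weightedSum-[] {w} {t ∷ L} ([] ∷ ks) = cong₂ _+_ (*-zeroʳ (w t)) (weightedSum-[] {w} ks)

counts-tabulate : ∀ {Z L} {n : PTree → ℕ} → (∀ {t} → t ∈ L → Count t Z (n t)) → Counts Z L (map n L)
counts-tabulate {L = []}    _ = []
counts-tabulate {L = t ∷ L} k = k (here refl) ∷ counts-tabulate (k ∘ there)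

counts-uncons-absent : ∀ {y Z L cs} → Count y L 0 → Counts (y ∷ Z) L cs → Counts Z L cs
counts-uncons-absent []           []              = []
counts-uncons-absent (miss t≇y _) (hit y≅t _ ∷ _) = ⊥-elim (t≇y (≅-sym y≅t))
counts-uncons-absent (miss _ y∉L) (miss _ k ∷ ks) = k ∷ counts-uncons-absent y∉L ks

counts-uncons : ∀ {w y Z L cs} → Count y L 1 → Counts (y ∷ Z) L cs →
  ∃[ cs′ ] Counts Z L cs′ × ∃[ t ] t ∈ L × t ≅ y × weightedSum w L cs ≡ w t + weightedSum w L cs′
counts-uncons {w} {L = t ∷ L} {suc c ∷ cs} (hit t≅y y∉L) (hit _ k ∷ ks) =
  c ∷ cs , k ∷ counts-uncons-absent y∉L ks , t , here refl , t≅y ,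
  ≡.trans (cong (_+ weightedSum w L cs) (*-suc (w t) c)) (+-assoc (w t) (w t * c) _)
counts-uncons (hit t≅y _)  (miss y≇t _ ∷ _) = ⊥-elim (y≇t (≅-sym t≅y))
counts-uncons (miss t≇y _) (hit y≅t _ ∷ _)  = ⊥-elim (t≇y (≅-sym y≅t))
counts-uncons {w} {L = t ∷ L} {c ∷ cs} (miss _ y∈L) (miss _ k ∷ ks) with counts-uncons {w} y∈L ks
... | cs′ , ks′ , u , u∈L , u≅y , eq =
  c ∷ cs′ , k ∷ ks′ , u , there u∈L , u≅y ,
  ≡.trans (cong (w t * c +_) eq) (x∙yz≈y∙xz (w t * c) (w u) (weightedSum w L cs′))
  where open import Algebra.Properties.CommutativeSemigroup +-commutativeSemigroup using (x∙yz≈y∙xz)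

module _ (f : PTree → List PTree) (f-resp : ∀ {s t} → s ≅ t → f s ↭ᵢ f t) {x : PTree} where

  count-by-representatives : ∀ {w Z L cs} → All (λ z → Count z L 1) Z → All (λ t → Count x (f t) (w t)) L →
                             Counts Z L cs → Count x (concatMap f Z) (weightedSum w L cs)
  count-by-representatives {w} {[]}    []             _      ks =
    subst (Count x []) (sym (weightedSum-[] {w} ks)) []
  count-by-representatives {w} {y ∷ Z} (y-rep ∷ reps) coeffs ks with counts-uncons {w} y-rep ks
  ... | _ , ks′ , t , t∈L , t≅y , eq = subst (Count x (f y ++ concatMap f Z)) (sym eq)
    (count-++ (count-resp (f-resp t≅y) (All.lookup coeffs t∈L)) (count-by-representatives reps coeffs ks′))

NCoeff⇒Count : ∀ {j t c} → size t ≡ suc j → NCoeff • t c → Count t (𝔑• j) c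
NCoeff⇒Count {t = t} {c} ∣t∣ = subst (λ s → Count t (𝔑• (s ∸ 1)) c) ∣t∣

MCoeff⇒Count : ∀ {a x t c} → size t ≡ a + size x → MCoeff x t c → Count x (iter a 𝔓 [ t ]) c
MCoeff⇒Count {a} {x} {t} {c} ∣t∣ =
  subst (λ j → Count x (iter j 𝔓 [ t ]) c) (≡.trans (cong (_∸ size x) ∣t∣) (m+n∸n≡m a (size x)))

proposition2p8 : (k a : ℕ) (x : PTree) → size x ≡ suc k
    → (L : List PTree) → Reps (k + a + 1) L
    → (m n : PTree → ℕ)
    → (∀ t → t ∈ L → MCoeff x t (m t) × NCoeff • t (n t))
    → (nx : ℕ) → NCoeff • x nx
    → sum (map (λ t → m t * n t) L) ≡ nx * prodC k a
proposition2p8 k a x ∣x∣ L (L-size , L-reps) m n coeffs nx nx-coeff = begin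
  sum (map (λ t → m t * n t) L)  ≡⟨ weightedSum-map m n L ⟨
  weightedSum m L (map n L)      ≡⟨ count-unique via-representatives via-commutator ⟩
  prodC k a * nx                 ≡⟨ *-comm (prodC k a) nx ⟩
  nx * prodC k a                 ∎
  where
  open ≡-Reasoning
  ∣t∣≡1+k+a : ∀ {t} → t ∈ L → size t ≡ suc (k + a)
  ∣t∣≡1+k+a t∈L = ≡.trans (L-size _ t∈L) (+-comm (k + a) 1)

  ∣t∣≡a+∣x∣ : ∀ {t} → t ∈ L → size t ≡ a + size x
  ∣t∣≡a+∣x∣ t∈L = ≡.trans (∣t∣≡1+k+a t∈L)
    (≡.trans (cong suc (+-comm k a)) (≡.trans (sym (+-suc a k)) (cong (a +_) (sym ∣x∣))))

  via-commutator : Count x (iter a 𝔓 (𝔑• (k + a))) (prodC k a * nx)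
  via-commutator = count-resp (↭⇒↭ᵢ (↭-sym (𝔓ᵃ-𝔑• k a))) (count-· (prodC k a) (NCoeff⇒Count ∣x∣ nx-coeff))

  via-representatives : Count x (iter a 𝔓 (𝔑• (k + a))) (weightedSum m L (map n L))
  via-representatives = subst (λ Z → Count x Z _) (sym (iter-concatMap prunes a (𝔑• (k + a))))
    (count-by-representatives (λ t → iter a 𝔓 [ t ]) (λ s≅t → iter-𝔓-resp a (Perm.prep s≅t (Perm.refl [])))
      (All.map (λ ∣z∣ → L-reps _ (≡.trans ∣z∣ (+-comm 1 (k + a)))) (𝔑•-size (k + a)))
      (All.tabulate (λ t∈L → MCoeff⇒Count (∣t∣≡a+∣x∣ t∈L) (proj₁ (coeffs _ t∈L))))
      (counts-tabulate (λ t∈L → NCoeff⇒Count (∣t∣≡1+k+a t∈L) (proj₂ (coeffs _ t∈L)))))
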